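{- Let $\mathcal{G}$ be a finite simple undirected graph. Let $A$ be the set of vertices $v$ of $\mathcal{G}$ such that the single-vertex subgraph $\{v\}$ is a proper F-twin, and let $B$ be the set of endvertices of edges of $\mathcal{G}$ whose induced $K_2$ subgraph is a proper F-twin. Then $A\cap B=\emptyset$.
   Context: All graphs are finite, undirected, without loops or parallel edges. For a vertex $u$, $\mathcal{N}(u)$ denotes the set of vertices adjacent to $u$. Two induced subgraphs $H_1,H_2$ of $\mathcal{G}$ with vertex sets $V_1,V_2$ are called F-twins if there is a graph isomorphism $\varphi:V_1\to V_2$ between $H_1$ and $H_2$ such that $\mathcal{N}(u)-V_1=\mathcal{N}(\varphi(u))-V_2$ for all $u\in V_1$. An induced subgraph is a proper F-twin if it has an F-twin different from itself. An edge $uv$ is identified with the subgraph ($\cong K_2$) induced by $\{u,v\}$. -}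

module Defs where

open import Data.Nat using (ℕ)
open import Data.Bool using (Bool; true; false)
open import Data.Fin using (Fin)
open import Data.Fin.Subset using (Subset; _∈_; _∉_; ⁅_⁆; _∪_)
open import Data.Product using (Σ; ∃; _×_; proj₁)
open import Relation.Binary.PropositionalEquality using (_≡_; _≢_)
open import Relation.Nullary using (¬_)
open import Function.Bundles using (_⇔_)
open import Function.Definitions using (Bijective)

record Graph (n : ℕ) : Set where
  field
    adj   : Fin n → Fin n → Bool
    sym   : ∀ u v → adj u v ≡ adj v u
    irrefl : ∀ v → adj v v ≡ false

module _ {n : ℕ} (G : Graph n) where
  open Graph G

  Adj : Fin n → Fin n → Set
  Adj u v = adj u v ≡ true

  Vtx : Subset n → Set
  Vtx V = Σ (Fin n) (λ x → x ∈ V)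

  -- H1 = G[V1] and H2 = G[V2] are F-twins: there is a graph isomorphism
  -- φ : V1 → V2 between the induced subgraphs such that
  -- N(u) - V1 = N(φ u) - V2 for all u ∈ V1.
  FTwins : Subset n → Subset n → Set
  FTwins V₁ V₂ =
    Σ (Vtx V₁ → Vtx V₂) λ φ →
      Bijective _≡_ _≡_ φ
      × (∀ u v → (Adj (proj₁ u) (proj₁ v) ⇔ Adj (proj₁ (φ u)) (proj₁ (φ v))))
      × (∀ u w → ((Adj (proj₁ u) w × w ∉ V₁) ⇔ (Adj (proj₁ (φ u)) w × w ∉ V₂)))

  -- an induced subgraph (given by its vertex set) is a proper F-twin if it has
  -- an F-twin different from itself (induced subgraphs = vertex sets)
  ProperFTwin : Subset n → Set
  ProperFTwin V = ∃ λ V′ → V′ ≢ V × FTwins V V′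

  InA : Fin n → Set
  InA v = ProperFTwin ⁅ v ⁆

  InB : Fin n → Set
  InB v = ∃ λ u → Adj u v × ProperFTwin (⁅ u ⁆ ∪ ⁅ v ⁆)

-- If {v} has a proper F-twin {w}, then v and w are false twins: N(v) = N(w) and w ≠ v.
-- Now let uv be an edge whose K₂ has an F-twin {a, b}, with u ↦ a and v ↦ b.
-- The common neighbour w of u lies outside {u, v}, so a is adjacent to w and
-- a ≠ w; hence a ∈ N(w) = N(v).  If a ≠ u, then a ∈ N(v) − {u, v} = N(b) − {a, b},
-- which is absurd; so a = u.  If b ≠ v, then v ∈ N(a) − {a, b} = N(u) − {u, v},
-- again absurd; so b = v and the twin {a, b} is {u, v} itself.
module Submission where

open import Defs
open import Data.Nat using (ℕ)
open import Data.Fin using (Fin; _≟_)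
open import Data.Fin.Subset using (Subset; _∈_; _∉_; ⁅_⁆; _∪_)
open import Data.Fin.Subset.Properties
  using (x∈⁅x⁆; x∈⁅y⁆⇒x≡y; x≢y⇒x∉⁅y⁆; x∈p∪q⁻; x∈p∪q⁺; ⊆-antisym)
open import Data.Vec.Properties.WithK using ([]=-irrelevant)
open import Data.Product using (_×_; _,_; proj₁; proj₂; ∃; ∃₂)
open import Data.Sum using (_⊎_; inj₁; inj₂; [_,_])
import Data.Sum as Sum
open import Function.Bundles using (_⇔_; mk⇔; Equivalence)
open import Relation.Binary.PropositionalEquality
  using (_≡_; _≢_; refl; sym; trans; cong; subst)
open import Relation.Nullary using (¬_)
open import Relation.Nullary.Decidable using (decidable-stable)

open Equivalence using (to; from)

private
  variable
    n : ℕ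

x∈⁅x,y⁆ : (x y : Fin n) → x ∈ ⁅ x ⁆ ∪ ⁅ y ⁆
x∈⁅x,y⁆ x y = x∈p∪q⁺ (inj₁ (x∈⁅x⁆ x))

y∈⁅x,y⁆ : (x y : Fin n) → y ∈ ⁅ x ⁆ ∪ ⁅ y ⁆
y∈⁅x,y⁆ x y = x∈p∪q⁺ {p = ⁅ x ⁆} (inj₂ (x∈⁅x⁆ y))

z∈⁅x,y⁆⇒z≡x⊎z≡y : ∀ {x y z : Fin n} → z ∈ ⁅ x ⁆ ∪ ⁅ y ⁆ → z ≡ x ⊎ z ≡ y
z∈⁅x,y⁆⇒z≡x⊎z≡y {x = x} {y} z∈ =
  Sum.map (x∈⁅y⁆⇒x≡y x) (x∈⁅y⁆⇒x≡y y) (x∈p∪q⁻ ⁅ x ⁆ ⁅ y ⁆ z∈)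

z≢x⇒z≢y⇒z∉⁅x,y⁆ : ∀ {x y z : Fin n} → z ≢ x → z ≢ y → z ∉ ⁅ x ⁆ ∪ ⁅ y ⁆
z≢x⇒z≢y⇒z∉⁅x,y⁆ z≢x z≢y z∈ = [ z≢x , z≢y ] (z∈⁅x,y⁆⇒z≡x⊎z≡y z∈)

module _ {n : ℕ} (G : Graph n) where
  open Graph G renaming (sym to adj-sym)

  Adj-sym : ∀ {x y} → Adj G x y → Adj G y x
  Adj-sym {x} {y} xy = trans (adj-sym y x) xy

  Adj⇒≢ : ∀ {x y} → Adj G x y → x ≢ y
  Adj⇒≢ {x} xx refl with trans (sym xx) (irrefl x)
  ... | ()

  Vtx-≡ : ∀ {V} {z z′ : Vtx G V} → proj₁ z ≡ proj₁ z′ → z ≡ z′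
  Vtx-≡ {z = x , p} {.x , q} refl = cong (x ,_) ([]=-irrelevant p q)

  Vtx-⁅x⁆ : ∀ {x} (z : Vtx G ⁅ x ⁆) → z ≡ (x , x∈⁅x⁆ x)
  Vtx-⁅x⁆ {x} (y , y∈) = Vtx-≡ (x∈⁅y⁆⇒x≡y x y∈)

  Vtx-⁅x,y⁆ : ∀ {x y} (z : Vtx G (⁅ x ⁆ ∪ ⁅ y ⁆)) →
              z ≡ (x , x∈⁅x,y⁆ x y) ⊎ z ≡ (y , y∈⁅x,y⁆ x y)
  Vtx-⁅x,y⁆ (z , z∈) = Sum.map Vtx-≡ Vtx-≡ (z∈⁅x,y⁆⇒z≡x⊎z≡y z∈)

  SameOutsideNeighbours : Fin n → Subset n → Fin n → Subset n → Set
  SameOutsideNeighbours x U x′ U′ =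
    ∀ y → (Adj G x y × y ∉ U) ⇔ (Adj G x′ y × y ∉ U′)

  module _ {V₁ V₂ : Subset n} (t : FTwins G V₁ V₂) where
    private
      φ = proj₁ t

    image : Vtx G V₁ → Fin n
    image z = proj₁ (φ z)

    image∈ : ∀ z → image z ∈ V₂
    image∈ z = proj₂ (φ z)

    ∈⇒image : ∀ {y} → y ∈ V₂ → ∃ λ z → image z ≡ y
    ∈⇒image {y} y∈ with proj₂ (proj₁ (proj₂ t)) (y , y∈)
    ... | z , φz≡y = z , cong proj₁ (φz≡y refl)

    image-sameOutside : ∀ z → SameOutsideNeighbours (proj₁ z) V₁ (image z) V₂
    image-sameOutside = proj₂ (proj₂ (proj₂ t))

  singleton-twin : ∀ {x V} (t : FTwins G ⁅ x ⁆ V) →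
    ∃ λ x′ → V ≡ ⁅ x′ ⁆ × SameOutsideNeighbours x ⁅ x ⁆ x′ V
  singleton-twin {x} {V} t = image t zx , V≡ , image-sameOutside t zx
    where
    zx = (x , x∈⁅x⁆ x)

    image∈⁅x′⁆ : ∀ z → image t z ∈ ⁅ image t zx ⁆
    image∈⁅x′⁆ z with Vtx-⁅x⁆ z
    ... | refl = x∈⁅x⁆ _

    V≡ : V ≡ ⁅ image t zx ⁆
    V≡ = ⊆-antisym
      (λ y∈ → let z , z↦ = ∈⇒image t y∈ in subst (_∈ _) z↦ (image∈⁅x′⁆ z))
      (λ y∈ → subst (_∈ V) (sym (x∈⁅y⁆⇒x≡y _ y∈)) (image∈ t zx))

  pair-twin : ∀ {x y V} (t : FTwins G (⁅ x ⁆ ∪ ⁅ y ⁆) V) →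
    ∃₂ λ x′ y′ → V ≡ ⁅ x′ ⁆ ∪ ⁅ y′ ⁆
               × SameOutsideNeighbours x (⁅ x ⁆ ∪ ⁅ y ⁆) x′ V
               × SameOutsideNeighbours y (⁅ x ⁆ ∪ ⁅ y ⁆) y′ V
  pair-twin {x} {y} {V} t =
    image t zx , image t zy , V≡ , image-sameOutside t zx , image-sameOutside t zy
    where
    zx = (x , x∈⁅x,y⁆ x y)
    zy = (y , y∈⁅x,y⁆ x y)

    image∈⁅x′,y′⁆ : ∀ z → image t z ∈ ⁅ image t zx ⁆ ∪ ⁅ image t zy ⁆
    image∈⁅x′,y′⁆ z with Vtx-⁅x,y⁆ z
    ... | inj₁ refl = x∈⁅x,y⁆ _ _
    ... | inj₂ refl = y∈⁅x,y⁆ _ _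

    V≡ : V ≡ ⁅ image t zx ⁆ ∪ ⁅ image t zy ⁆
    V≡ = ⊆-antisym
      (λ y∈ → let z , z↦ = ∈⇒image t y∈ in subst (_∈ _) z↦ (image∈⁅x′,y′⁆ z))
      (λ y∈ → [ (λ { refl → image∈ t zx }) , (λ { refl → image∈ t zy }) ]
                (z∈⁅x,y⁆⇒z≡x⊎z≡y y∈))

  -- Without loops, N(x) − {x} = N(x).
  sameOutside⇒sameNeighbours : ∀ {x x′} →
    SameOutsideNeighbours x ⁅ x ⁆ x′ ⁅ x′ ⁆ → ∀ y → Adj G x y ⇔ Adj G x′ y
  sameOutside⇒sameNeighbours same y = mk⇔
    (λ xy → proj₁ (to (same y) (xy , outside xy)))
    (λ x′y → proj₁ (from (same y) (x′y , outside x′y)))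
    where
    outside : ∀ {x} → Adj G x y → y ∉ ⁅ x ⁆
    outside xy = x≢y⇒x∉⁅y⁆ (λ y≡x → Adj⇒≢ xy (sym y≡x))

  false-twin-fixes-edge-twin : ∀ {u v w a b} → w ≢ v → (∀ y → Adj G v y ⇔ Adj G w y) →
    Adj G u v →
    SameOutsideNeighbours u (⁅ u ⁆ ∪ ⁅ v ⁆) a (⁅ a ⁆ ∪ ⁅ b ⁆) →
    SameOutsideNeighbours v (⁅ u ⁆ ∪ ⁅ v ⁆) b (⁅ a ⁆ ∪ ⁅ b ⁆) →
    a ≡ u × b ≡ v
  false-twin-fixes-edge-twin {u} {v} {w} {a} {b} w≢v v~w uv sameᵤ sameᵥ = a≡u , b≡v
    where
    uw : Adj G u w
    uw = Adj-sym (to (v~w u) (Adj-sym uv))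

    aw×w∉⁅a,b⁆ : Adj G a w × w ∉ ⁅ a ⁆ ∪ ⁅ b ⁆
    aw×w∉⁅a,b⁆ = to (sameᵤ w) (uw , z≢x⇒z≢y⇒z∉⁅x,y⁆ (Adj⇒≢ (Adj-sym uw)) w≢v)

    va : Adj G v a
    va = from (v~w a) (Adj-sym (proj₁ aw×w∉⁅a,b⁆))

    a≡u : a ≡ u
    a≡u = decidable-stable (a ≟ u) λ a≢u →
      let a∉⁅u,v⁆ = z≢x⇒z≢y⇒z∉⁅x,y⁆ a≢u (Adj⇒≢ (Adj-sym va))
      in proj₂ (to (sameᵥ a) (va , a∉⁅u,v⁆)) (x∈⁅x,y⁆ a b)

    b≡v : b ≡ v
    b≡v = decidable-stable (b ≟ v) λ b≢v →
      let v∉⁅a,b⁆ = z≢x⇒z≢y⇒z∉⁅x,y⁆ (λ v≡a → Adj⇒≢ uv (sym (trans v≡a a≡u)))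
                                     (λ v≡b → b≢v (sym v≡b))
          av = subst (λ x → Adj G x v) (sym a≡u) uv
      in proj₂ (from (sameᵤ v) (av , v∉⁅a,b⁆)) (y∈⁅x,y⁆ u v)

corollary4 : (n : ℕ) (G : Graph n) (v : Fin n) → ¬ (InA G v × InB G v)
corollary4 n G v ((V , V≢⁅v⁆ , t) , (u , uv , V′ , V′≢⁅u,v⁆ , t′))
  with singleton-twin G t | pair-twin G t′
... | w , refl , sameᵥ | a , b , refl , sameᵤ′ , sameᵥ′
  with false-twin-fixes-edge-twin G (λ w≡v → V≢⁅v⁆ (cong ⁅_⁆ w≡v))
         (sameOutside⇒sameNeighbours G sameᵥ) uv sameᵤ′ sameᵥ′
... | refl , refl = V′≢⁅u,v⁆ refl
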